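{- Let $\vdash$ be either classical or intuitionistic propositional derivability. For every formula $A$ that is ${\sf par}$-projective, its projection (the $E\in\mathcal{L}({\sf par})$ for which $A$ is $E$-projective) is provably equivalent to the uniform post-interpolant of $A$ with respect to ${\sf par}$.
   Context: The language $\mathcal{L}$ is built from atoms ${\sf var}\cup{\sf par}$ (variables and parameters, disjoint infinite sets) using $\bot,\wedge,\vee,\to$. $\mathcal{L}({\sf par})$ is the set of formulas whose atoms are all parameters. A substitution is a map $\theta:\mathcal{L}\to\mathcal{L}$ commuting with connectives with $\theta(p)=p$ for all $p\in{\sf par}$. $\theta$ is an $A$-identity if $A\vdash\theta(a)\leftrightarrow a$ for every atom $a$. For $E\in\mathcal{L}({\sf par})$, $A$ is $E$-projective if there is an $A$-identity $\theta$ with $\vdash\theta(A)\leftrightarrow E$; $A$ is ${\sf par}$-projective if it is $E$-projective for some $E\in\mathcal{L}({\sf par})$. The uniform post-interpolant of $A$ w.r.t. ${\sf par}$ is a formula $B\in\mathcal{L}({\sf par})$ with $\vdash A\to B$ such that $\vdash B\to C$ for every $C\in\mathcal{L}({\sf par})$ with $\vdash A\to C$. -}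

module Defs where

open import Data.Nat using (ℕ)
open import Data.List using (List; []; _∷_)
open import Data.List.Membership.Propositional using (_∈_)
open import Data.Product using (Σ; _×_; _,_)
open import Data.Unit using (⊤)
open import Data.Empty using (⊥)
open import Relation.Binary.PropositionalEquality using (_≡_)

data Atom : Set where
  var : ℕ → Atom
  par : ℕ → Atom

infixr 6 _∧_
infixr 5 _∨_
infixr 4 _⇒_
data Fm : Set where
  at  : Atom → Fm
  ⊥'  : Fm
  _∧_ : Fm → Fm → Fm
  _∨_ : Fm → Fm → Fm
  _⇒_ : Fm → Fm → Fm

infix 3 _⇔_
_⇔_ : Fm → Fm → Fm
A ⇔ B = (A ⇒ B) ∧ (B ⇒ A)

¬' : Fm → Fm
¬' A = A ⇒ ⊥'

data Logic : Set where
  int cl : Logic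

infix 2 _⊢[_]_
data _⊢[_]_ : List Fm → Logic → Fm → Set where
  hyp  : ∀ {Γ L A} → A ∈ Γ → Γ ⊢[ L ] A
  ⊥E   : ∀ {Γ L A} → Γ ⊢[ L ] ⊥' → Γ ⊢[ L ] A
  ∧I   : ∀ {Γ L A B} → Γ ⊢[ L ] A → Γ ⊢[ L ] B → Γ ⊢[ L ] A ∧ B
  ∧E₁  : ∀ {Γ L A B} → Γ ⊢[ L ] A ∧ B → Γ ⊢[ L ] A
  ∧E₂  : ∀ {Γ L A B} → Γ ⊢[ L ] A ∧ B → Γ ⊢[ L ] B
  ∨I₁  : ∀ {Γ L A B} → Γ ⊢[ L ] A → Γ ⊢[ L ] A ∨ B
  ∨I₂  : ∀ {Γ L A B} → Γ ⊢[ L ] B → Γ ⊢[ L ] A ∨ B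
  ∨E   : ∀ {Γ L A B C} → Γ ⊢[ L ] A ∨ B → (A ∷ Γ) ⊢[ L ] C → (B ∷ Γ) ⊢[ L ] C
         → Γ ⊢[ L ] C
  ⇒I   : ∀ {Γ L A B} → (A ∷ Γ) ⊢[ L ] B → Γ ⊢[ L ] A ⇒ B
  ⇒E   : ∀ {Γ L A B} → Γ ⊢[ L ] A ⇒ B → Γ ⊢[ L ] A → Γ ⊢[ L ] B
  raa  : ∀ {Γ A} → (¬' A ∷ Γ) ⊢[ cl ] ⊥' → Γ ⊢[ cl ] A

infix 2 ⊢[_]_
⊢[_]_ : Logic → Fm → Set
⊢[ L ] A = [] ⊢[ L ] A

ParFm : Fm → Set
ParFm (at (var _)) = ⊥
ParFm (at (par _)) = ⊤
ParFm ⊥'      = ⊤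
ParFm (A ∧ B) = ParFm A × ParFm B
ParFm (A ∨ B) = ParFm A × ParFm B
ParFm (A ⇒ B) = ParFm A × ParFm B

Subst : Set
Subst = ℕ → Fm

substAt : Subst → Atom → Fm
substAt θ (var n) = θ n
substAt θ (par p) = at (par p)

sub : Subst → Fm → Fm
sub θ (at a)  = substAt θ a
sub θ ⊥'      = ⊥'
sub θ (A ∧ B) = sub θ A ∧ sub θ B
sub θ (A ∨ B) = sub θ A ∨ sub θ B
sub θ (A ⇒ B) = sub θ A ⇒ sub θ B

IsIdentityFor : Logic → Fm → Subst → Set
IsIdentityFor L A θ = ∀ (a : Atom) → (A ∷ []) ⊢[ L ] (sub θ (at a) ⇔ at a)

Projective : Logic → Fm → Fm → Set
Projective L A E = ParFm E × Σ Subst (λ θ → IsIdentityFor L A θ × (⊢[ L ] (sub θ A ⇔ E)))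

UniformPostInterpolant : Logic → Fm → Fm → Set
UniformPostInterpolant L A B =
  ParFm B × (⊢[ L ] (A ⇒ B)) × (∀ C → ParFm C → ⊢[ L ] (A ⇒ C) → ⊢[ L ] (B ⇒ C))

-- Let θ witness that A is E-projective.  Since θ is an A-identity, A ⊢ θ(A) ↔ A,
-- so ⊢ A → E and hence ⊢ B → E by uniformity of B.  Conversely, substituting θ
-- into ⊢ A → B leaves the parametric formula B fixed, so ⊢ θ(A) → B, i.e. ⊢ E → B.
module Submission where

open import Defs
open import Data.List using (List; []; _∷_; map)
open import Data.List.Membership.Propositional using (_∈_)
open import Data.List.Relation.Unary.Any using (here; there)
open import Data.List.Membership.Propositional.Properties using (∈-map⁺)
open import Data.Product using (_,_)
open import Relation.Binary.PropositionalEquality using (_≡_; refl; cong₂; subst)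

private
  variable
    L : Logic
    Γ Δ : List Fm
    A C E F F′ G G′ : Fm

_⊆_ : List Fm → List Fm → Set
Γ ⊆ Δ = ∀ {F} → F ∈ Γ → F ∈ Δ

⊆-∷ : Γ ⊆ Δ → (F ∷ Γ) ⊆ (F ∷ Δ)
⊆-∷ ρ (here p)  = here p
⊆-∷ ρ (there p) = there (ρ p)

weaken : Γ ⊆ Δ → Γ ⊢[ L ] F → Δ ⊢[ L ] F
weaken ρ (hyp x)    = hyp (ρ x)
weaken ρ (⊥E d)     = ⊥E (weaken ρ d)
weaken ρ (∧I d e)   = ∧I (weaken ρ d) (weaken ρ e)
weaken ρ (∧E₁ d)    = ∧E₁ (weaken ρ d)
weaken ρ (∧E₂ d)    = ∧E₂ (weaken ρ d)
weaken ρ (∨I₁ d)    = ∨I₁ (weaken ρ d)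
weaken ρ (∨I₂ d)    = ∨I₂ (weaken ρ d)
weaken ρ (∨E d e f) = ∨E (weaken ρ d) (weaken (⊆-∷ ρ) e) (weaken (⊆-∷ ρ) f)
weaken ρ (⇒I d)     = ⇒I (weaken (⊆-∷ ρ) d)
weaken ρ (⇒E d e)   = ⇒E (weaken ρ d) (weaken ρ e)
weaken ρ (raa d)    = raa (weaken (⊆-∷ ρ) d)

weaken-∷ : Γ ⊢[ L ] F → (G ∷ Γ) ⊢[ L ] F
weaken-∷ = weaken there

weaken-closed : ⊢[ L ] F → Γ ⊢[ L ] F
weaken-closed = weaken (λ ())

assumption : (F ∷ Γ) ⊢[ L ] F
assumption = hyp (here refl)

⇔-to : Γ ⊢[ L ] (F ⇔ G) → Γ ⊢[ L ] F → Γ ⊢[ L ] G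
⇔-to e = ⇒E (∧E₁ e)

⇔-from : Γ ⊢[ L ] (F ⇔ G) → Γ ⊢[ L ] G → Γ ⊢[ L ] F
⇔-from e = ⇒E (∧E₂ e)

⇔-refl : Γ ⊢[ L ] (F ⇔ F)
⇔-refl = ∧I (⇒I assumption) (⇒I assumption)

⇔-sym : Γ ⊢[ L ] (F ⇔ G) → Γ ⊢[ L ] (G ⇔ F)
⇔-sym e = ∧I (∧E₂ e) (∧E₁ e)

∧-mono : Γ ⊢[ L ] (F ⇔ F′) → Γ ⊢[ L ] (G ⇔ G′) → Γ ⊢[ L ] (F ∧ G ⇒ F′ ∧ G′)
∧-mono e f = ⇒I (∧I (⇔-to (weaken-∷ e) (∧E₁ assumption))
                    (⇔-to (weaken-∷ f) (∧E₂ assumption)))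

∨-mono : Γ ⊢[ L ] (F ⇔ F′) → Γ ⊢[ L ] (G ⇔ G′) → Γ ⊢[ L ] (F ∨ G ⇒ F′ ∨ G′)
∨-mono e f = ⇒I (∨E assumption
  (∨I₁ (⇔-to (weaken-∷ (weaken-∷ e)) assumption))
  (∨I₂ (⇔-to (weaken-∷ (weaken-∷ f)) assumption)))

⇒-mono : Γ ⊢[ L ] (F ⇔ F′) → Γ ⊢[ L ] (G ⇔ G′) → Γ ⊢[ L ] ((F ⇒ G) ⇒ (F′ ⇒ G′))
⇒-mono e f = ⇒I (⇒I (⇔-to (weaken-∷ (weaken-∷ f))
  (⇒E (weaken-∷ assumption) (⇔-from (weaken-∷ (weaken-∷ e)) assumption))))

∧-cong : Γ ⊢[ L ] (F ⇔ F′) → Γ ⊢[ L ] (G ⇔ G′) → Γ ⊢[ L ] (F ∧ G ⇔ F′ ∧ G′)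
∧-cong e f = ∧I (∧-mono e f) (∧-mono (⇔-sym e) (⇔-sym f))

∨-cong : Γ ⊢[ L ] (F ⇔ F′) → Γ ⊢[ L ] (G ⇔ G′) → Γ ⊢[ L ] (F ∨ G ⇔ F′ ∨ G′)
∨-cong e f = ∧I (∨-mono e f) (∨-mono (⇔-sym e) (⇔-sym f))

⇒-cong : Γ ⊢[ L ] (F ⇔ F′) → Γ ⊢[ L ] (G ⇔ G′) → Γ ⊢[ L ] ((F ⇒ G) ⇔ (F′ ⇒ G′))
⇒-cong e f = ∧I (⇒-mono e f) (⇒-mono (⇔-sym e) (⇔-sym f))

sub-⊢ : (θ : Subst) → Γ ⊢[ L ] F → map (sub θ) Γ ⊢[ L ] sub θ F
sub-⊢ θ (hyp x)    = hyp (∈-map⁺ (sub θ) x)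
sub-⊢ θ (⊥E d)     = ⊥E (sub-⊢ θ d)
sub-⊢ θ (∧I d e)   = ∧I (sub-⊢ θ d) (sub-⊢ θ e)
sub-⊢ θ (∧E₁ d)    = ∧E₁ (sub-⊢ θ d)
sub-⊢ θ (∧E₂ d)    = ∧E₂ (sub-⊢ θ d)
sub-⊢ θ (∨I₁ d)    = ∨I₁ (sub-⊢ θ d)
sub-⊢ θ (∨I₂ d)    = ∨I₂ (sub-⊢ θ d)
sub-⊢ θ (∨E d e f) = ∨E (sub-⊢ θ d) (sub-⊢ θ e) (sub-⊢ θ f)
sub-⊢ θ (⇒I d)     = ⇒I (sub-⊢ θ d)
sub-⊢ θ (⇒E d e)   = ⇒E (sub-⊢ θ d) (sub-⊢ θ e)
sub-⊢ θ (raa d)    = raa (sub-⊢ θ d)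

sub-par : (θ : Subst) → ParFm F → sub θ F ≡ F
sub-par {at (par _)} θ _       = refl
sub-par {⊥'}         θ _       = refl
sub-par {F ∧ G}      θ (p , q) = cong₂ _∧_ (sub-par θ p) (sub-par θ q)
sub-par {F ∨ G}      θ (p , q) = cong₂ _∨_ (sub-par θ p) (sub-par θ q)
sub-par {F ⇒ G}      θ (p , q) = cong₂ _⇒_ (sub-par θ p) (sub-par θ q)

sub-⊢-par-consequence : (θ : Subst) → ParFm C → ⊢[ L ] (A ⇒ C) → ⊢[ L ] (sub θ A ⇒ C)
sub-⊢-par-consequence {C = C} {L = L} {A = A} θ pC d =
  subst (λ X → ⊢[ L ] (sub θ A ⇒ X)) (sub-par θ pC) (sub-⊢ θ d)

sub-⇔-self : (θ : Subst) → (∀ a → Γ ⊢[ L ] (sub θ (at a) ⇔ at a))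
           → ∀ F → Γ ⊢[ L ] (sub θ F ⇔ F)
sub-⇔-self θ h (at a)  = h a
sub-⇔-self θ h ⊥'      = ⇔-refl
sub-⇔-self θ h (F ∧ G) = ∧-cong (sub-⇔-self θ h F) (sub-⇔-self θ h G)
sub-⇔-self θ h (F ∨ G) = ∨-cong (sub-⇔-self θ h F) (sub-⇔-self θ h G)
sub-⇔-self θ h (F ⇒ G) = ⇒-cong (sub-⇔-self θ h F) (sub-⇔-self θ h G)

projective⇒implies-projection : Projective L A E → ⊢[ L ] (A ⇒ E)
projective⇒implies-projection {A = A} (_ , θ , idθ , θA⇔E) =
  ⇒I (⇔-to (weaken-closed θA⇔E) (⇔-from (sub-⇔-self θ idθ A) assumption))

projection-implies-par-consequences :
  Projective L A E → ParFm C → ⊢[ L ] (A ⇒ C) → ⊢[ L ] (E ⇒ C)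
projection-implies-par-consequences (_ , θ , _ , θA⇔E) pC A⇒C =
  ⇒I (⇒E (weaken-∷ (sub-⊢-par-consequence θ pC A⇒C))
         (⇔-from (weaken-∷ θA⇔E) assumption))

theorem2p2 : ∀ (L : Logic) (A E B : Fm) → Projective L A E
    → UniformPostInterpolant L A B → ⊢[ L ] (E ⇔ B)
theorem2p2 L A E B proj@(pE , _) (pB , A⇒B , uniform) =
  ∧I (projection-implies-par-consequences proj pB A⇒B)
     (uniform E pE (projective⇒implies-projection proj))
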